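{- There is a bijection $\phi$ from the set of bargraphs with at least two $U$ steps to itself that preserves the number of $U$ steps and the number of $H$ steps and satisfies $\mathrm{iuc}(\phi(A))=\mathrm{lhs}(A)-1$ for every such $A$. Consequently, for all $n\ge3$ and $1\le h\le n-2$, $$|\{A\in\mathcal B_n:\mathrm{lhs}(A)=h\}|=|\{A\in\mathcal B_n:\mathrm{iuc}(A)=h-1\}|,$$ and, with $K$ and $I$ the generating functions $\sum_G t^{\mathrm{lhs}(G)}x^{\#H(G)}y^{\#U(G)}$ and $\sum_G t^{\mathrm{iuc}(G)}x^{\#H(G)}y^{\#U(G)}$ over all bargraphs, $K-\frac{txy}{1-tx}=t\left(I-\frac{txy}{1-tx}\right)$.
   Context: A bargraph is a lattice path with steps $U=(0,1)$, $H=(1,0)$, $D=(0,-1)$, identified with its word over $\{U,H,D\}$, that starts at the origin, ends on the $x$-axis, stays strictly above the $x$-axis except at its endpoints, and contains no two consecutive steps $UD$ or $DU$ (the empty path is not a bargraph). Its semiperimeter is its number of $U$ steps plus its number of $H$ steps, and $\mathcal B_n$ is the set of bargraphs of semiperimeter $n$; $\#H(G)$, $\#U(G)$ are the numbers of $H$ and $U$ steps. $\mathrm{lhs}(A)$ is the length of the first maximal run of consecutive $H$ steps of $A$. $\mathrm{iuc}(A)$ is the largest $j\ge0$ such that $A$ begins with $UH^j$. -}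

module Defs where

open import Data.Bool using (Bool; true; false; _∧_; not; if_then_else_; T)
open import Data.Nat using (ℕ; zero; suc; _+_; _*_; _∸_; _≡ᵇ_)
open import Data.Integer as ℤ using (ℤ; +_; 0ℤ; 1ℤ; -1ℤ)
open import Data.List using (List; []; _∷_; length; filter; concatMap; map; upTo)
open import Relation.Nullary.Decidable using (⌊_⌋)
open import Relation.Unary using (Decidable)
open import Data.Bool.Properties using (T?)

data Step : Set where
  U H D : Step

Path : Set
Path = List Step

δ : Step → ℤ
δ U = 1ℤ
δ H = 0ℤ
δ D = -1ℤ

aboveAndEnds : ℤ → Path → Bool
aboveAndEnds h []            = false
aboveAndEnds h (s ∷ [])      = ⌊ (h ℤ.+ δ s) ℤ.≟ 0ℤ ⌋
aboveAndEnds h (s ∷ t ∷ w)   = ⌊ 0ℤ ℤ.<? (h ℤ.+ δ s) ⌋ ∧ aboveAndEnds (h ℤ.+ δ s) (t ∷ w)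

noUDorDU : Path → Bool
noUDorDU []            = true
noUDorDU (_ ∷ [])      = true
noUDorDU (U ∷ D ∷ w)   = false
noUDorDU (D ∷ U ∷ w)   = false
noUDorDU (_ ∷ t ∷ w)   = noUDorDU (t ∷ w)

isBargraph : Path → Bool
isBargraph []      = false
isBargraph (s ∷ w) = aboveAndEnds 0ℤ (s ∷ w) ∧ noUDorDU (s ∷ w)

IsBargraph : Path → Set
IsBargraph w = T (isBargraph w)

#U : Path → ℕ
#U []      = 0
#U (U ∷ w) = suc (#U w)
#U (_ ∷ w) = #U w

#H : Path → ℕ
#H []      = 0
#H (H ∷ w) = suc (#H w)
#H (_ ∷ w) = #H w

semiperimeter : Path → ℕ
semiperimeter w = #U w + #H w

leadingH : Path → ℕ
leadingH (H ∷ w) = suc (leadingH w)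
leadingH _       = 0

lhs : Path → ℕ
lhs []      = 0
lhs (H ∷ w) = leadingH (H ∷ w)
lhs (_ ∷ w) = lhs w

-- iuc: largest j ≥ 0 such that the path begins with U H^j.
-- Convention: 0 if the path does not begin with U (this only happens for
-- the one-step bargraph H).
iuc : Path → ℕ
iuc (U ∷ w) = leadingH w
iuc _       = 0

wordsOfLength : ℕ → List Path
wordsOfLength zero    = [] ∷ []
wordsOfLength (suc k) = concatMap (λ w → (U ∷ w) ∷ (H ∷ w) ∷ (D ∷ w) ∷ []) (wordsOfLength k)

-- a bargraph of semiperimeter n has length 2·#U + #H ≤ 2n,
-- so all of them occur among the words of length < 2n+1
B : ℕ → List Path
B n = filter (λ w → T? (isBargraph w ∧ (semiperimeter w ≡ᵇ n)))
             (concatMap wordsOfLength (upTo (suc (2 * n))))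

countB : ℕ → (Path → Bool) → ℕ
countB n p = length (filter (λ w → T? (p w)) (B n))

-- Formal power series in t, x, y with integer coefficients, represented
-- by their coefficient functions: F k a b = [t^k x^a y^b] F.

FPS : Set
FPS = ℕ → ℕ → ℕ → ℤ

_−ₛ_ : FPS → FPS → FPS
(F −ₛ G) k a b = F k a b ℤ.- G k a b

t·_ : FPS → FPS
(t· F) zero    a b = 0ℤ
(t· F) (suc k) a b = F k a b

-- the series  t x y / (1 - t x) = Σ_{j ≥ 1} t^j x^j y
txyOver1-tx : FPS
txyOver1-tx k a b = if (k ≡ᵇ a) ∧ not (k ≡ᵇ 0) ∧ (b ≡ᵇ 1) then 1ℤ else 0ℤ

-- Σ_G t^{st(G)} x^{#H(G)} y^{#U(G)} over all bargraphs G.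
-- The coefficient of x^a y^b only involves bargraphs of semiperimeter a+b.
bargraphGF : (Path → ℕ) → FPS
bargraphGF st k a b =
  + countB (a + b) (λ G → (st G ≡ᵇ k) ∧ (#H G ≡ᵇ a) ∧ (#U G ≡ᵇ b))

K : FPS
K = bargraphGF lhs

I : FPS
I = bargraphGF iuc

-- A bargraph with at least two U steps factors uniquely as U H^a U^(b+1) H^(e+1) Y with Y not
-- starting with H; then iuc = a, while lhs = a if a > 0 and lhs = e + 1 if a = 0.  For a > 0, φ
-- moves one H step from the first H-run to the run after the rise U^(b+1); for a = 0 it moves e of
-- the e + 1 steps of that run in front of the rise.  Either way only H steps are traded between the
-- two runs flanking the rise, so the result is again a bargraph with the same numbers of U and H
-- steps, and iuc (φ A) = lhs A - 1; ψ moves them back.  The bargraphs with fewer than two U steps,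
-- H and the rows U H^(m+1) D, are counted by hand.  All counts are over B n, a duplicate-free list
-- whose members are exactly the bargraphs of semiperimeter n, so a bijection between two selections
-- of B n shows that they have the same length.

module Submission where

open import Defs
open import Data.Bool using (Bool; true; false; _∧_; not; if_then_else_; T)
open import Data.Bool.Properties using (T-∧; T?; ∧-zeroʳ)
open import Data.Empty using (⊥; ⊥-elim)
open import Data.Integer as ℤ using (0ℤ)
import Data.Integer.Properties as ℤ
open import Data.List using (List; []; _∷_; _++_; replicate; null; length; concatMap; filter; map; drop; upTo)
open import Data.List.Properties using (length-map; map-∘; map-id-local)
open import Data.List.Membership.Propositional using (_∈_; find; lose)
open import Data.List.Membership.Propositional.Properties
  using (∈-concatMap⁺; ∈-concatMap⁻; ∈-filter⁺; ∈-filter⁻; ∈-upTo⁺; ∈-map⁺; ∈-map⁻)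
open import Data.List.Membership.Propositional.Properties.WithK using (unique∧set⇒bag)
open import Data.List.Relation.Binary.BagAndSetEquality using (∼bag⇒↭)
open import Data.List.Relation.Binary.Permutation.Propositional.Properties using (↭-length)
open import Data.List.Relation.Unary.All using ([]; _∷_)
import Data.List.Relation.Unary.All as All
import Data.List.Relation.Unary.All.Properties as All
open import Data.List.Relation.Unary.AllPairs using ([]; _∷_)
import Data.List.Relation.Unary.AllPairs as AllPairs
import Data.List.Relation.Unary.AllPairs.Properties as AllPairs
open import Data.List.Relation.Unary.Any using (here; there)
open import Data.List.Relation.Unary.Unique.Propositional using (Unique)
import Data.List.Relation.Unary.Unique.Propositional.Properties as Unique
open import Data.Nat using (ℕ; zero; suc; _+_; _*_; _∸_; _≤_; _<_; s≤s; z≤n; _≡ᵇ_; _≟_)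
open import Data.Nat.Properties
  using (+-suc; +-comm; +-assoc; +-identityʳ; +-monoʳ-≤; m≤m+n; n≮n; <⇒≤; suc-injective; ≡ᵇ⇒≡; ≡⇒≡ᵇ; module ≤-Reasoning)
open import Data.Product using (Σ; _×_; _,_; proj₁; proj₂; map₁)
open import Data.Sum using (_⊎_; inj₁; inj₂)
open import Function.Bundles using (_⇔_; mk⇔; Equivalence)
open import Function.Construct.Composition using (_⇔-∘_)
open import Function.Construct.Symmetry using (⇔-sym)
open import Relation.Binary.PropositionalEquality
open import Relation.Nullary using (¬_; yes; no)
open import Relation.Nullary.Decidable using (⌊_⌋)

H^_ U^_ : ℕ → Path
H^ n = replicate n H
U^ n = replicate n U

infix 20 H^_ U^_

StartsWith : Step → Path → Set
StartsWith s []      = ⊥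
StartsWith s (t ∷ _) = s ≡ t

data Run (s : Step) : Path → Set where
  run : ∀ n r → ¬ StartsWith s r → Run s (replicate n s ++ r)

runH : ∀ w → Run H w
runH []      = run 0 [] λ ()
runH (U ∷ w) = run 0 (U ∷ w) λ ()
runH (D ∷ w) = run 0 (D ∷ w) λ ()
runH (H ∷ w) with runH w
... | run n r r≢H = run (suc n) r r≢H

runU : ∀ w → Run U w
runU []      = run 0 [] λ ()
runU (H ∷ w) = run 0 (H ∷ w) λ ()
runU (D ∷ w) = run 0 (D ∷ w) λ ()
runU (U ∷ w) with runU w
... | run n r r≢U = run (suc n) r r≢U

aboveAndEndsFrom : ℕ → Path → Bool
aboveAndEndsFrom h             []      = false
aboveAndEndsFrom h             (U ∷ w) = aboveAndEndsFrom (suc h) w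
aboveAndEndsFrom zero          (H ∷ w) = null w
aboveAndEndsFrom (suc h)       (H ∷ w) = aboveAndEndsFrom (suc h) w
aboveAndEndsFrom zero          (D ∷ w) = false
aboveAndEndsFrom (suc zero)    (D ∷ w) = null w
aboveAndEndsFrom (suc (suc h)) (D ∷ w) = aboveAndEndsFrom (suc h) w

continueAbove-≡ : ∀ {z z′} w → z ≡ z′ →
  ⌊ 0ℤ ℤ.<? z ⌋ ∧ aboveAndEnds z w ≡ ⌊ 0ℤ ℤ.<? z′ ⌋ ∧ aboveAndEnds z′ w
continueAbove-≡ w = cong (λ z → ⌊ 0ℤ ℤ.<? z ⌋ ∧ aboveAndEnds z w)

aboveAndEnds-+ : ∀ h w → aboveAndEnds (ℤ.+ h) w ≡ aboveAndEndsFrom h w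
aboveAndEnds-+ h             []          = refl
aboveAndEnds-+ h             (U ∷ [])    rewrite +-comm h 1 = refl
aboveAndEnds-+ h             (U ∷ t ∷ w) =
  trans (continueAbove-≡ (t ∷ w) (cong ℤ.+_ (+-comm h 1))) (aboveAndEnds-+ (suc h) (t ∷ w))
aboveAndEnds-+ zero          (H ∷ [])    = refl
aboveAndEnds-+ zero          (H ∷ t ∷ w) = refl
aboveAndEnds-+ (suc h)       (H ∷ [])    = refl
aboveAndEnds-+ (suc h)       (H ∷ t ∷ w) =
  trans (continueAbove-≡ (t ∷ w) (cong ℤ.+_ (+-identityʳ (suc h)))) (aboveAndEnds-+ (suc h) (t ∷ w))
aboveAndEnds-+ zero          (D ∷ [])    = refl
aboveAndEnds-+ zero          (D ∷ t ∷ w) = refl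
aboveAndEnds-+ (suc zero)    (D ∷ [])    = refl
aboveAndEnds-+ (suc zero)    (D ∷ t ∷ w) = refl
aboveAndEnds-+ (suc (suc h)) (D ∷ [])    = refl
aboveAndEnds-+ (suc (suc h)) (D ∷ t ∷ w) = aboveAndEnds-+ (suc h) (t ∷ w)

isBargraph-ℕ : ∀ w → isBargraph w ≡ aboveAndEndsFrom 0 w ∧ noUDorDU w
isBargraph-ℕ []      = refl
isBargraph-ℕ (s ∷ w) = cong (_∧ noUDorDU (s ∷ w)) (aboveAndEnds-+ 0 (s ∷ w))

aboveAndEndsFrom-H^ : ∀ h n w → aboveAndEndsFrom (suc h) (H^ n ++ w) ≡ aboveAndEndsFrom (suc h) w
aboveAndEndsFrom-H^ h zero    w = refl
aboveAndEndsFrom-H^ h (suc n) w = aboveAndEndsFrom-H^ h n w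

aboveAndEndsFrom-U^ : ∀ h n w → aboveAndEndsFrom h (U^ n ++ w) ≡ aboveAndEndsFrom (n + h) w
aboveAndEndsFrom-U^ h zero    w = refl
aboveAndEndsFrom-U^ h (suc n) w = trans (aboveAndEndsFrom-U^ (suc h) n w) (cong (λ k → aboveAndEndsFrom k w) (+-suc n h))

noUDorDU-H : ∀ w → noUDorDU (H ∷ w) ≡ noUDorDU w
noUDorDU-H []      = refl
noUDorDU-H (_ ∷ _) = refl

noUDorDU-U : ∀ {w} → ¬ StartsWith D w → noUDorDU (U ∷ w) ≡ noUDorDU w
noUDorDU-U {[]}    _   = refl
noUDorDU-U {U ∷ w} _   = refl
noUDorDU-U {H ∷ w} _   = refl
noUDorDU-U {D ∷ w} w≢D = ⊥-elim (w≢D refl)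

noUDorDU-H^ : ∀ n w → noUDorDU (H^ n ++ w) ≡ noUDorDU w
noUDorDU-H^ zero    w = refl
noUDorDU-H^ (suc n) w = trans (noUDorDU-H (H^ n ++ w)) (noUDorDU-H^ n w)

noUDorDU-U^ : ∀ n {w} → ¬ StartsWith D w → noUDorDU (U^ n ++ w) ≡ noUDorDU w
noUDorDU-U^ zero    w≢D = refl
noUDorDU-U^ (suc n) w≢D = trans (noUDorDU-U (U^n++w≢D n)) (noUDorDU-U^ n w≢D)
  where
  U^n++w≢D : ∀ n → ¬ StartsWith D (U^ n ++ _)
  U^n++w≢D zero    = w≢D
  U^n++w≢D (suc n) = λ ()

#D : Path → ℕ
#D []      = 0
#D (D ∷ w) = suc (#D w)
#D (_ ∷ w) = #D w

length≡semiperimeter+#D : ∀ w → length w ≡ semiperimeter w + #D w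
length≡semiperimeter+#D []      = refl
length≡semiperimeter+#D (U ∷ w) = cong suc (length≡semiperimeter+#D w)
length≡semiperimeter+#D (H ∷ w) =
  trans (cong suc (length≡semiperimeter+#D w)) (cong (_+ #D w) (sym (+-suc (#U w) (#H w))))
length≡semiperimeter+#D (D ∷ w) =
  trans (cong suc (length≡semiperimeter+#D w)) (sym (+-suc (semiperimeter w) (#D w)))

#D≡height+#U : ∀ h w → T (aboveAndEndsFrom h w) → #D w ≡ h + #U w
#D≡height+#U h             (U ∷ w)  above = trans (#D≡height+#U (suc h) w above) (sym (+-suc h (#U w)))
#D≡height+#U zero          (H ∷ []) _     = refl
#D≡height+#U (suc h)       (H ∷ w)  above = #D≡height+#U (suc h) w above
#D≡height+#U (suc zero)    (D ∷ []) _     = refl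
#D≡height+#U (suc (suc h)) (D ∷ w)  above = cong suc (#D≡height+#U (suc h) w above)

length-bargraph : ∀ {A} → IsBargraph A → length A ≤ 2 * semiperimeter A
length-bargraph {A} bg = begin
  length A                         ≡⟨ length≡semiperimeter+#D A ⟩
  semiperimeter A + #D A           ≡⟨ cong (semiperimeter A +_) #D≡#U ⟩
  semiperimeter A + #U A           ≤⟨ +-monoʳ-≤ (semiperimeter A) (m≤m+n (#U A) (#H A)) ⟩
  semiperimeter A + semiperimeter A ≡⟨ cong (semiperimeter A +_) (+-identityʳ (semiperimeter A)) ⟨
  2 * semiperimeter A              ∎
  where
  open ≤-Reasoning
  #D≡#U : #D A ≡ #U A
  #D≡#U = #D≡height+#U 0 A (proj₁ (Equivalence.to T-∧ (subst T (isBargraph-ℕ A) bg)))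

concatMap-unique : ∀ {X Y : Set} (f : X → List Y) {xs} → Unique xs → (∀ x → Unique (f x)) →
                   (∀ {x y z} → z ∈ f x → z ∈ f y → x ≡ y) → Unique (concatMap f xs)
concatMap-unique f uxs uf sep =
  Unique.concat⁺ (All.map⁺ (All.universal uf _))
                 (AllPairs.map⁺ (AllPairs.map (λ x≢y {_} (z∈fx , z∈fy) → x≢y (sep z∈fx z∈fy)) uxs))

extensions : Path → List Path
extensions w = (U ∷ w) ∷ (H ∷ w) ∷ (D ∷ w) ∷ []

∈-extensions⁻ : ∀ {w v} → v ∈ extensions w → Σ Step λ s → v ≡ s ∷ w
∈-extensions⁻ (here refl)                 = U , refl
∈-extensions⁻ (there (here refl))         = H , refl
∈-extensions⁻ (there (there (here refl))) = D , refl

∈-extensions⁺ : ∀ s w → s ∷ w ∈ extensions w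
∈-extensions⁺ U w = here refl
∈-extensions⁺ H w = there (here refl)
∈-extensions⁺ D w = there (there (here refl))

∈-wordsOfLength⁻ : ∀ k {w} → w ∈ wordsOfLength k → length w ≡ k
∈-wordsOfLength⁻ zero    (here refl) = refl
∈-wordsOfLength⁻ (suc k) w∈ with find (∈-concatMap⁻ extensions {xs = wordsOfLength k} w∈)
... | v , v∈ , w∈ext with ∈-extensions⁻ w∈ext
... | _ , refl = cong suc (∈-wordsOfLength⁻ k v∈)

∈-wordsOfLength⁺ : ∀ w → w ∈ wordsOfLength (length w)
∈-wordsOfLength⁺ []      = here refl
∈-wordsOfLength⁺ (s ∷ w) = ∈-concatMap⁺ extensions (lose (∈-wordsOfLength⁺ w) (∈-extensions⁺ s w))

wordsOfLength-unique : ∀ k → Unique (wordsOfLength k)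
wordsOfLength-unique zero    = [] ∷ []
wordsOfLength-unique (suc k) =
  concatMap-unique extensions (wordsOfLength-unique k)
    (λ _ → ((λ ()) ∷ (λ ()) ∷ []) ∷ ((λ ()) ∷ []) ∷ [] ∷ [])
    (λ z∈x z∈y → trans (sym (tail-≡ z∈x)) (tail-≡ z∈y))
  where
  tail-≡ : ∀ {w v} → v ∈ extensions w → drop 1 v ≡ w
  tail-≡ v∈ with ∈-extensions⁻ v∈
  ... | _ , refl = refl

𝓑 : ℕ → Path → Set
𝓑 n A = IsBargraph A × semiperimeter A ≡ n

is𝓑 : ℕ → Path → Bool
is𝓑 n w = isBargraph w ∧ (semiperimeter w ≡ᵇ n)

∈-B⇔ : ∀ {n A} → A ∈ B n ⇔ 𝓑 n A
∈-B⇔ {n} {A} = mk⇔ to from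
  where
  words : List Path
  words = concatMap wordsOfLength (upTo (suc (2 * n)))
  to : A ∈ B n → 𝓑 n A
  to A∈ with bg , sp ← Equivalence.to T-∧ (proj₂ (∈-filter⁻ (λ w → T? (is𝓑 n w)) {xs = words} A∈))
    = bg , ≡ᵇ⇒≡ _ _ sp
  from : 𝓑 n A → A ∈ B n
  from (bg , refl) =
    ∈-filter⁺ (λ w → T? (is𝓑 n w))
      (∈-concatMap⁺ wordsOfLength (lose (∈-upTo⁺ (s≤s (length-bargraph {A} bg))) (∈-wordsOfLength⁺ A)))
      (Equivalence.from T-∧ (bg , ≡⇒≡ᵇ (semiperimeter A) _ refl))

B-unique : ∀ n → Unique (B n)
B-unique n =
  Unique.filter⁺ (λ w → T? (is𝓑 n w))
    (concatMap-unique wordsOfLength (Unique.upTo⁺ (suc (2 * n))) wordsOfLength-unique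
      (λ {k} {l} z∈k z∈l → trans (sym (∈-wordsOfLength⁻ k z∈k)) (∈-wordsOfLength⁻ l z∈l)))

selected : ℕ → (Path → Bool) → List Path
selected n p = filter (λ w → T? (p w)) (B n)

∈-selected⇔ : ∀ {n p A} → A ∈ selected n p ⇔ (𝓑 n A × T (p A))
∈-selected⇔ {n} {p} {A} = mk⇔ to from
  where
  to : A ∈ selected n p → 𝓑 n A × T (p A)
  to A∈ = let A∈B , pA = ∈-filter⁻ (λ w → T? (p w)) {xs = B n} A∈ in Equivalence.to ∈-B⇔ A∈B , pA
  from : 𝓑 n A × T (p A) → A ∈ selected n p
  from (bA , pA) = ∈-filter⁺ (λ w → T? (p w)) (Equivalence.from ∈-B⇔ bA) pA

countB-≡-length : ∀ {n p ys} → Unique ys → (∀ {A} → A ∈ ys ⇔ (𝓑 n A × T (p A))) → countB n p ≡ length ys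
countB-≡-length {n} {p} uys ys⇔ =
  ↭-length (∼bag⇒↭ (unique∧set⇒bag (Unique.filter⁺ (λ w → T? (p w)) (B-unique n)) uys
                                   (⇔-sym ys⇔ ⇔-∘ ∈-selected⇔)))

countB-bij : ∀ {n} {p q : Path → Bool} (f g : Path → Path) →
  (∀ {A} → 𝓑 n A → T (p A) → 𝓑 n (f A) × T (q (f A)) × g (f A) ≡ A) →
  (∀ {A} → 𝓑 n A → T (q A) → 𝓑 n (g A) × T (p (g A)) × f (g A) ≡ A) →
  countB n p ≡ countB n q
countB-bij {n} {p} {q} f g forth back = begin
  countB n p                    ≡⟨ length-map f (selected n p) ⟨
  length (map f (selected n p)) ≡⟨ countB-≡-length image-unique image⇔ ⟨
  countB n q                    ∎
  where
  open ≡-Reasoning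
  g∘f≡id : map g (map f (selected n p)) ≡ selected n p
  g∘f≡id = trans (sym (map-∘ (selected n p)))
                 (map-id-local (All.tabulate λ A∈ → let bA , pA = Equivalence.to ∈-selected⇔ A∈ in proj₂ (proj₂ (forth bA pA))))
  image-unique : Unique (map f (selected n p))
  image-unique = Unique.map⁻ (subst Unique (sym g∘f≡id) (Unique.filter⁺ (λ w → T? (p w)) (B-unique n)))
  image⇔ : ∀ {A} → A ∈ map f (selected n p) ⇔ (𝓑 n A × T (q A))
  image⇔ {A} = mk⇔ to from
    where
    to : A ∈ map f (selected n p) → 𝓑 n A × T (q A)
    to A∈ with ∈-map⁻ f A∈
    ... | A₀ , A₀∈ , refl = let bA₀ , pA₀ = Equivalence.to ∈-selected⇔ A₀∈ ; bA , qA , _ = forth bA₀ pA₀ in bA , qA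
    from : 𝓑 n A × T (q A) → A ∈ map f (selected n p)
    from (bA , qA) = let bgA , pgA , fgA≡A = back bA qA in
      subst (_∈ map f (selected n p)) fgA≡A (∈-map⁺ f (Equivalence.from ∈-selected⇔ (bgA , pgA)))

countB-none : ∀ {n p} → (∀ A → 𝓑 n A → ¬ T (p A)) → countB n p ≡ 0
countB-none none = countB-≡-length [] (mk⇔ (λ ()) λ (bA , pA) → ⊥-elim (none _ bA pA))

countB-single : ∀ {n p w} → 𝓑 n w → T (p w) → (∀ A → 𝓑 n A → T (p A) → A ≡ w) → countB n p ≡ 1
countB-single bw pw unique =
  countB-≡-length ([] ∷ []) (mk⇔ (λ { (here refl) → bw , pw }) λ (bA , pA) → here (unique _ bA pA))

countB-cong : ∀ {n} {p q : Path → Bool} → (∀ A → 𝓑 n A → T (p A) ⇔ T (q A)) → countB n p ≡ countB n q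
countB-cong p⇔q = countB-bij (λ A → A) (λ A → A)
  (λ {A} bA pA → bA , Equivalence.to (p⇔q A bA) pA , refl)
  (λ {A} bA qA → bA , Equivalence.from (p⇔q A bA) qA , refl)

block : ℕ → ℕ → ℕ → Path → Path
block a b e Y = U ∷ H^ a ++ U^ b ++ H^ e ++ Y

isBargraph-block : ∀ a b e Y → isBargraph (block a b (suc e) Y) ≡ aboveAndEndsFrom (suc b) Y ∧ noUDorDU Y
isBargraph-block a b e Y = begin
  isBargraph (block a b (suc e) Y)
    ≡⟨ isBargraph-ℕ (block a b (suc e) Y) ⟩
  aboveAndEndsFrom 1 (H^ a ++ U^ b ++ H^ suc e ++ Y) ∧ noUDorDU (block a b (suc e) Y)
    ≡⟨ cong₂ _∧_ heights steps ⟩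
  aboveAndEndsFrom (suc b) Y ∧ noUDorDU Y ∎
  where
  open ≡-Reasoning
  heights : aboveAndEndsFrom 1 (H^ a ++ U^ b ++ H^ suc e ++ Y) ≡ aboveAndEndsFrom (suc b) Y
  heights = begin
    aboveAndEndsFrom 1 (H^ a ++ U^ b ++ H^ suc e ++ Y) ≡⟨ aboveAndEndsFrom-H^ 0 a _ ⟩
    aboveAndEndsFrom 1 (U^ b ++ H^ suc e ++ Y)        ≡⟨ aboveAndEndsFrom-U^ 1 b _ ⟩
    aboveAndEndsFrom (b + 1) (H^ suc e ++ Y)           ≡⟨ cong (λ h → aboveAndEndsFrom h (H^ suc e ++ Y)) (+-comm b 1) ⟩
    aboveAndEndsFrom (suc b) (H^ suc e ++ Y)           ≡⟨ aboveAndEndsFrom-H^ b (suc e) Y ⟩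
    aboveAndEndsFrom (suc b) Y                         ∎
  noD : ∀ a b → ¬ StartsWith D (H^ a ++ U^ b ++ H^ suc e ++ Y)
  noD (suc a) b       = λ ()
  noD zero    (suc b) = λ ()
  noD zero    zero    = λ ()
  steps : noUDorDU (block a b (suc e) Y) ≡ noUDorDU Y
  steps = begin
    noUDorDU (block a b (suc e) Y)          ≡⟨ noUDorDU-U (noD a b) ⟩
    noUDorDU (H^ a ++ U^ b ++ H^ suc e ++ Y) ≡⟨ noUDorDU-H^ a _ ⟩
    noUDorDU (U^ b ++ H^ suc e ++ Y)         ≡⟨ noUDorDU-U^ b (λ ()) ⟩
    noUDorDU (H^ suc e ++ Y)                 ≡⟨ noUDorDU-H^ (suc e) Y ⟩
    noUDorDU Y                               ∎

#U-H^ : ∀ n w → #U (H^ n ++ w) ≡ #U w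
#U-H^ zero    w = refl
#U-H^ (suc n) w = #U-H^ n w

#U-U^ : ∀ n w → #U (U^ n ++ w) ≡ n + #U w
#U-U^ zero    w = refl
#U-U^ (suc n) w = cong suc (#U-U^ n w)

#H-H^ : ∀ n w → #H (H^ n ++ w) ≡ n + #H w
#H-H^ zero    w = refl
#H-H^ (suc n) w = cong suc (#H-H^ n w)

#H-U^ : ∀ n w → #H (U^ n ++ w) ≡ #H w
#H-U^ zero    w = refl
#H-U^ (suc n) w = #H-U^ n w

leadingH-H^ : ∀ n w → leadingH (H^ n ++ w) ≡ n + leadingH w
leadingH-H^ zero    w = refl
leadingH-H^ (suc n) w = cong suc (leadingH-H^ n w)

leadingH-¬H : ∀ {w} → ¬ StartsWith H w → leadingH w ≡ 0
leadingH-¬H {[]}    _   = refl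
leadingH-¬H {U ∷ w} _   = refl
leadingH-¬H {D ∷ w} _   = refl
leadingH-¬H {H ∷ w} w≢H = ⊥-elim (w≢H refl)

lhs-U^ : ∀ n w → lhs (U^ n ++ w) ≡ lhs w
lhs-U^ zero    w = refl
lhs-U^ (suc n) w = lhs-U^ n w

#U-block : ∀ a b e Y → #U (block a b e Y) ≡ suc (b + #U Y)
#U-block a b e Y = cong suc (begin
  #U (H^ a ++ U^ b ++ H^ e ++ Y) ≡⟨ #U-H^ a _ ⟩
  #U (U^ b ++ H^ e ++ Y)        ≡⟨ #U-U^ b _ ⟩
  b + #U (H^ e ++ Y)            ≡⟨ cong (λ k → b + k) (#U-H^ e Y) ⟩
  b + #U Y                      ∎)
  where open ≡-Reasoning

#H-block : ∀ a b e Y → #H (block a b e Y) ≡ a + (e + #H Y)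
#H-block a b e Y = begin
  #H (H^ a ++ U^ b ++ H^ e ++ Y) ≡⟨ #H-H^ a _ ⟩
  a + #H (U^ b ++ H^ e ++ Y)    ≡⟨ cong (λ k → a + k) (#H-U^ b _) ⟩
  a + #H (H^ e ++ Y)            ≡⟨ cong (λ k → a + k) (#H-H^ e Y) ⟩
  a + (e + #H Y)                ∎
  where open ≡-Reasoning

iuc-block : ∀ a b e Y → iuc (block a (suc b) e Y) ≡ a
iuc-block a b e Y = trans (leadingH-H^ a _) (+-identityʳ a)

lhs-block-lead : ∀ a b e Y → lhs (block (suc a) (suc b) e Y) ≡ suc a
lhs-block-lead a b e Y = cong suc (trans (leadingH-H^ a _) (+-identityʳ a))

lhs-block-noLead : ∀ b e {Y} → ¬ StartsWith H Y → lhs (block 0 b (suc e) Y) ≡ suc e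
lhs-block-noLead b e {Y} Y≢H = begin
  lhs (U^ b ++ H^ suc e ++ Y) ≡⟨ lhs-U^ b _ ⟩
  suc (leadingH (H^ e ++ Y))  ≡⟨ cong suc (leadingH-H^ e Y) ⟩
  suc (e + leadingH Y)        ≡⟨ cong (λ k → suc (e + k)) (leadingH-¬H Y≢H) ⟩
  suc (e + 0)                 ≡⟨ cong suc (+-identityʳ e) ⟩
  suc e                       ∎
  where open ≡-Reasoning

data BlockForm : Path → Set where
  blockForm : ∀ a b e Y → ¬ StartsWith H Y → BlockForm (block a (suc b) (suc e) Y)

row : ℕ → Path
row m = U ∷ H^ suc m ++ D ∷ []

data Shape : Path → Set where
  flat   : Shape (H ∷ [])
  oneRow : ∀ m → Shape (row m)
  blocks : ∀ {A} → BlockForm A → Shape A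

noUDorDU-U^D : ∀ b z → ¬ T (noUDorDU (U^ suc b ++ D ∷ z))
noUDorDU-U^D zero    z = λ ()
noUDorDU-U^D (suc b) z = noUDorDU-U^D b z

-- The clauses left out are those in which the height hypothesis computes to T false.
shape : ∀ {A} → IsBargraph A → Shape A
shape {A} bg = shapeOf A (Equivalence.to T-∧ (subst T (isBargraph-ℕ A) bg))
  where
  afterRise : ∀ a b r → ¬ StartsWith U r → T (aboveAndEndsFrom (b + 2) r) →
              T (noUDorDU (U ∷ H^ a ++ U^ suc b ++ r)) → Shape (U ∷ H^ a ++ U^ suc b ++ r)
  afterRise a b (U ∷ r) r≢U _ _ = ⊥-elim (r≢U refl)
  afterRise a b (H ∷ r) _ _ _ with runH r
  ... | run e Y Y≢H = blocks (blockForm a b e Y Y≢H)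
  afterRise a b (D ∷ r) _ _ steps =
    ⊥-elim (noUDorDU-U^D b r (subst T (trans (noUDorDU-U {H^ a ++ U^ suc b ++ D ∷ r} (noD a)) (noUDorDU-H^ a _)) steps))
    where
    noD : ∀ a → ¬ StartsWith D (H^ a ++ U^ suc b ++ D ∷ r)
    noD zero    = λ ()
    noD (suc a) = λ ()

  afterLead : ∀ a r → ¬ StartsWith H r → T (aboveAndEndsFrom 1 r) →
              T (noUDorDU (U ∷ H^ a ++ r)) → Shape (U ∷ H^ a ++ r)
  afterLead a (H ∷ r) r≢H _ _ = ⊥-elim (r≢H refl)
  afterLead zero    (D ∷ []) _ _ ()
  afterLead (suc m) (D ∷ []) _ _ _ = oneRow m
  afterLead a (U ∷ r) _ above steps with runU r
  ... | run b r′ r′≢U = afterRise a b r′ r′≢U (subst T (aboveAndEndsFrom-U^ 2 b r′) above) steps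

  shapeOf : ∀ A → T (aboveAndEndsFrom 0 A) × T (noUDorDU A) → Shape A
  shapeOf (H ∷ []) _ = flat
  shapeOf (U ∷ w) (above , steps) with runH w
  ... | run a r r≢H = afterLead a r r≢H (subst T (aboveAndEndsFrom-H^ 0 a r) above) steps

leadingH-row : ∀ m → leadingH (H^ suc m ++ D ∷ []) ≡ suc m
leadingH-row m = trans (leadingH-H^ (suc m) (D ∷ [])) (+-identityʳ (suc m))

lhs-row iuc-row : ∀ m → lhs (row m) ≡ suc m
lhs-row = leadingH-row
iuc-row = leadingH-row

#U-row : ∀ m → #U (row m) ≡ 1
#U-row m = cong suc (#U-H^ (suc m) (D ∷ []))

#H-row : ∀ m → #H (row m) ≡ suc m
#H-row m = trans (#H-H^ (suc m) (D ∷ [])) (+-identityʳ (suc m))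

row-isBargraph : ∀ m → IsBargraph (row m)
row-isBargraph m = subst T (sym (trans (isBargraph-ℕ (row m)) (cong₂ _∧_ heights steps))) _
  where
  heights : aboveAndEndsFrom 0 (row m) ≡ true
  heights = aboveAndEndsFrom-H^ 0 (suc m) (D ∷ [])
  steps : noUDorDU (row m) ≡ true
  steps = trans (noUDorDU-U {H^ suc m ++ D ∷ []} λ ()) (noUDorDU-H^ (suc m) (D ∷ []))

BlockForm-2≤#U : ∀ {A} → BlockForm A → 2 ≤ #U A
BlockForm-2≤#U (blockForm a b e Y _) = subst (2 ≤_) (sym (#U-block a (suc b) (suc e) Y)) (s≤s (s≤s z≤n))

bargraph-BlockForm : ∀ A → IsBargraph A → 2 ≤ #U A → BlockForm A
bargraph-BlockForm A bg 2≤#U with shape {A} bg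
... | flat      with () ← 2≤#U
... | oneRow m  with s≤s () ← subst (2 ≤_) (#U-row m) 2≤#U
... | blocks bf = bf

#U≡0⇒flat : ∀ {A} → IsBargraph A → #U A ≡ 0 → A ≡ H ∷ []
#U≡0⇒flat {A} bg #U≡0 with shape {A} bg
... | flat      = refl
... | oneRow m  with () ← trans (sym #U≡0) (#U-row m)
... | blocks bf with () ← subst (2 ≤_) #U≡0 (BlockForm-2≤#U bf)

#U≡1⇒row : ∀ {A} → IsBargraph A → #U A ≡ 1 → Σ ℕ λ m → A ≡ row m
#U≡1⇒row {A} bg #U≡1 with shape {A} bg
... | flat      with () ← #U≡1
... | oneRow m  = m , refl
... | blocks bf with s≤s () ← subst (2 ≤_) #U≡1 (BlockForm-2≤#U bf)

spanH spanU : Path → ℕ × Path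
spanH (H ∷ w) = map₁ suc (spanH w)
spanH w       = 0 , w
spanU (U ∷ w) = map₁ suc (spanU w)
spanU w       = 0 , w

spanH-H^ : ∀ n {r} → ¬ StartsWith H r → spanH (H^ n ++ r) ≡ (n , r)
spanH-H^ zero    {[]}    _   = refl
spanH-H^ zero    {U ∷ r} _   = refl
spanH-H^ zero    {D ∷ r} _   = refl
spanH-H^ zero    {H ∷ r} r≢H = ⊥-elim (r≢H refl)
spanH-H^ (suc n)         r≢H = cong (map₁ suc) (spanH-H^ n r≢H)

spanU-U^ : ∀ n {r} → ¬ StartsWith U r → spanU (U^ n ++ r) ≡ (n , r)
spanU-U^ zero    {[]}    _   = refl
spanU-U^ zero    {H ∷ r} _   = refl
spanU-U^ zero    {D ∷ r} _   = refl
spanU-U^ zero    {U ∷ r} r≢U = ⊥-elim (r≢U refl)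
spanU-U^ (suc n)         r≢U = cong (map₁ suc) (spanU-U^ n r≢U)

parse : Path → ℕ × ℕ × ℕ × Path
parse w =
  let (a , w₁) = spanH w
      (b , w₂) = spanU w₁
      (e , Y)  = spanH w₂
  in  a , b , e , Y

parse-block : ∀ a b e {Y} → ¬ StartsWith H Y → parse (H^ a ++ U^ suc b ++ H^ suc e ++ Y) ≡ (a , suc b , suc e , Y)
parse-block a b e {Y} Y≢H
  rewrite spanH-H^ a {U^ suc b ++ H^ suc e ++ Y} (λ ())
        | spanU-U^ b {H^ suc e ++ Y} (λ ())
        | spanH-H^ e Y≢H
  = refl

-- The clauses with e = 0 never apply to a block form.
φᵇ ψᵇ : ℕ × ℕ × ℕ × Path → Path
φᵇ (zero  , b , zero  , Y) = block 0 b 0 Y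
φᵇ (zero  , b , suc e , Y) = block e b 1 Y
φᵇ (suc a , b , e     , Y) = block a b (suc e) Y
ψᵇ (a , b , zero        , Y) = block a b 0 Y
ψᵇ (a , b , suc zero    , Y) = block 0 b (suc a) Y
ψᵇ (a , b , suc (suc e) , Y) = block (suc a) b (suc e) Y

φ ψ : Path → Path
φ (U ∷ w) = φᵇ (parse w)
φ A       = A
ψ (U ∷ w) = ψᵇ (parse w)
ψ A       = A

φ-block : ∀ a b e {Y} → ¬ StartsWith H Y → φ (block a (suc b) (suc e) Y) ≡ φᵇ (a , suc b , suc e , Y)
φ-block a b e Y≢H = cong φᵇ (parse-block a b e Y≢H)

ψ-block : ∀ a b e {Y} → ¬ StartsWith H Y → ψ (block a (suc b) (suc e) Y) ≡ ψᵇ (a , suc b , suc e , Y)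
ψ-block a b e Y≢H = cong ψᵇ (parse-block a b e Y≢H)

data Rebalancing : Path → Path → Set where
  rebalance : ∀ {a e a′ e′} b Y → ¬ StartsWith H Y → a′ + e′ ≡ a + e →
              Rebalancing (block a (suc b) (suc e) Y) (block a′ (suc b) (suc e′) Y)

φ-rebalancing : ∀ {A} → BlockForm A → Rebalancing A (φ A)
φ-rebalancing (blockForm zero b e Y Y≢H) =
  subst (Rebalancing _) (sym (φ-block 0 b e Y≢H)) (rebalance {0} {e} {e} {0} b Y Y≢H (+-identityʳ e))
φ-rebalancing (blockForm (suc a) b e Y Y≢H) =
  subst (Rebalancing _) (sym (φ-block (suc a) b e Y≢H)) (rebalance {suc a} {e} {a} {suc e} b Y Y≢H (+-suc a e))

ψ-rebalancing : ∀ {A} → BlockForm A → Rebalancing A (ψ A)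
ψ-rebalancing (blockForm a b zero Y Y≢H) =
  subst (Rebalancing _) (sym (ψ-block a b 0 Y≢H)) (rebalance {a} {0} {0} {a} b Y Y≢H (sym (+-identityʳ a)))
ψ-rebalancing (blockForm a b (suc e) Y Y≢H) =
  subst (Rebalancing _) (sym (ψ-block a b (suc e) Y≢H)) (rebalance {a} {suc e} {suc a} {e} b Y Y≢H (sym (+-suc a e)))

ψ∘φ : ∀ {A} → BlockForm A → ψ (φ A) ≡ A
ψ∘φ (blockForm zero    b e Y Y≢H) = trans (cong ψ (φ-block 0 b e Y≢H)) (ψ-block e b 0 Y≢H)
ψ∘φ (blockForm (suc a) b e Y Y≢H) = trans (cong ψ (φ-block (suc a) b e Y≢H)) (ψ-block a b (suc e) Y≢H)

φ∘ψ : ∀ {A} → BlockForm A → φ (ψ A) ≡ A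
φ∘ψ (blockForm a b zero    Y Y≢H) = trans (cong φ (ψ-block a b 0 Y≢H)) (φ-block 0 b a Y≢H)
φ∘ψ (blockForm a b (suc e) Y Y≢H) = trans (cong φ (ψ-block a b (suc e) Y≢H)) (φ-block (suc a) b e Y≢H)

lhs≡suc-iuc∘φ : ∀ {A} → BlockForm A → lhs A ≡ suc (iuc (φ A))
lhs≡suc-iuc∘φ (blockForm zero b e Y Y≢H) = begin
  lhs (block 0 (suc b) (suc e) Y)   ≡⟨ lhs-block-noLead (suc b) e Y≢H ⟩
  suc e                             ≡⟨ cong suc (iuc-block e b 1 Y) ⟨
  suc (iuc (block e (suc b) 1 Y))   ≡⟨ cong (λ A → suc (iuc A)) (φ-block 0 b e Y≢H) ⟨
  suc (iuc (φ (block 0 (suc b) (suc e) Y))) ∎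
  where open ≡-Reasoning
lhs≡suc-iuc∘φ (blockForm (suc a) b e Y Y≢H) = begin
  lhs (block (suc a) (suc b) (suc e) Y)   ≡⟨ lhs-block-lead a b (suc e) Y ⟩
  suc a                                   ≡⟨ cong suc (iuc-block a b (suc (suc e)) Y) ⟨
  suc (iuc (block a (suc b) (suc (suc e)) Y)) ≡⟨ cong (λ A → suc (iuc A)) (φ-block (suc a) b e Y≢H) ⟨
  suc (iuc (φ (block (suc a) (suc b) (suc e) Y))) ∎
  where open ≡-Reasoning

rebalancing-BlockForm : ∀ {A A′} → Rebalancing A A′ → BlockForm A′
rebalancing-BlockForm (rebalance {a′ = a′} {e′} b Y Y≢H _) = blockForm a′ b e′ Y Y≢H

rebalancing-#U : ∀ {A A′} → Rebalancing A A′ → #U A′ ≡ #U A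
rebalancing-#U (rebalance {a} {e} {a′} {e′} b Y _ _) =
  trans (#U-block a′ (suc b) (suc e′) Y) (sym (#U-block a (suc b) (suc e) Y))

rebalancing-#H : ∀ {A A′} → Rebalancing A A′ → #H A′ ≡ #H A
rebalancing-#H (rebalance {a} {e} {a′} {e′} b Y _ a′+e′≡a+e) = begin
  #H (block a′ (suc b) (suc e′) Y) ≡⟨ #H-block a′ (suc b) (suc e′) Y ⟩
  a′ + (suc e′ + #H Y)             ≡⟨ regroup a′ e′ ⟩
  suc (a′ + e′) + #H Y             ≡⟨ cong (λ k → suc k + #H Y) a′+e′≡a+e ⟩
  suc (a + e) + #H Y               ≡⟨ regroup a e ⟨
  a + (suc e + #H Y)               ≡⟨ #H-block a (suc b) (suc e) Y ⟨
  #H (block a (suc b) (suc e) Y)   ∎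
  where
  open ≡-Reasoning
  regroup : ∀ x y → x + (suc y + #H Y) ≡ suc (x + y) + #H Y
  regroup x y = trans (sym (+-assoc x (suc y) (#H Y))) (cong (_+ #H Y) (+-suc x y))

rebalancing-isBargraph : ∀ {A A′} → Rebalancing A A′ → isBargraph A′ ≡ isBargraph A
rebalancing-isBargraph (rebalance {a} {e} {a′} {e′} b Y _ _) =
  trans (isBargraph-block a′ (suc b) e′ Y) (sym (isBargraph-block a (suc b) e Y))

rebalancing-IsBargraph : ∀ {A A′} → Rebalancing A A′ → IsBargraph A → IsBargraph A′
rebalancing-IsBargraph r = subst T (sym (rebalancing-isBargraph r))

rebalancing-𝓑 : ∀ {n A A′} → Rebalancing A A′ → 𝓑 n A → 𝓑 n A′
rebalancing-𝓑 r (bg , sp) = rebalancing-IsBargraph r bg , trans (cong₂ _+_ (rebalancing-#U r) (rebalancing-#H r)) sp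

rebalancing-domain : ∀ {A A′} → Rebalancing A A′ → IsBargraph A → IsBargraph A′ × 2 ≤ #U A′
rebalancing-domain r bg = rebalancing-IsBargraph r bg , BlockForm-2≤#U (rebalancing-BlockForm r)

lhs∘ψ≡suc-iuc : ∀ {A} → BlockForm A → lhs (ψ A) ≡ suc (iuc A)
lhs∘ψ≡suc-iuc bf =
  trans (lhs≡suc-iuc∘φ (rebalancing-BlockForm (ψ-rebalancing bf))) (cong (λ A → suc (iuc A)) (φ∘ψ bf))

T-cong₃ : ∀ (P : ℕ → ℕ → ℕ → Bool) {l l′ h h′ u u′} → l ≡ l′ → h ≡ h′ → u ≡ u′ → T (P l h u) → T (P l′ h′ u′)
T-cong₃ P refl refl refl t = t

-- For P l h u = (l ≡ᵇ suc k) ∧ …, the right-hand predicate computes to (iuc A ≡ᵇ k) ∧ ….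
countB-lhs≡suc-iuc : ∀ {n} (P : ℕ → ℕ → ℕ → Bool) →
  (∀ {A} → 𝓑 n A → T (P (lhs A) (#H A) (#U A)) ⊎ T (P (suc (iuc A)) (#H A) (#U A)) → BlockForm A) →
  countB n (λ A → P (lhs A) (#H A) (#U A)) ≡ countB n (λ A → P (suc (iuc A)) (#H A) (#U A))
countB-lhs≡suc-iuc {n} P toBlockForm = countB-bij φ ψ forth back
  where
  forth : ∀ {A} → 𝓑 n A → T (P (lhs A) (#H A) (#U A)) →
          𝓑 n (φ A) × T (P (suc (iuc (φ A))) (#H (φ A)) (#U (φ A))) × ψ (φ A) ≡ A
  forth bA t = let bf = toBlockForm bA (inj₁ t) ; r = φ-rebalancing bf in
    rebalancing-𝓑 r bA ,
    T-cong₃ P (lhs≡suc-iuc∘φ bf) (sym (rebalancing-#H r)) (sym (rebalancing-#U r)) t ,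
    ψ∘φ bf
  back : ∀ {A} → 𝓑 n A → T (P (suc (iuc A)) (#H A) (#U A)) →
         𝓑 n (ψ A) × T (P (lhs (ψ A)) (#H (ψ A)) (#U (ψ A))) × φ (ψ A) ≡ A
  back bA t = let bf = toBlockForm bA (inj₂ t) ; r = ψ-rebalancing bf in
    rebalancing-𝓑 r bA ,
    T-cong₃ P (sym (lhs∘ψ≡suc-iuc bf)) (sym (rebalancing-#H r)) (sym (rebalancing-#U r)) t ,
    φ∘ψ bf

semiperimeter-row : ∀ m → semiperimeter (row m) ≡ suc (suc m)
semiperimeter-row m = cong₂ _+_ (#U-row m) (#H-row m)

lhs-iuc-equidistributed : ∀ n h → 3 ≤ n → 1 ≤ h → h ≤ n ∸ 2 →
  countB n (λ A → lhs A ≡ᵇ h) ≡ countB n (λ A → iuc A ≡ᵇ (h ∸ 1))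
lhs-iuc-equidistributed n (suc h) 3≤n _ 1+h≤n∸2 = countB-lhs≡suc-iuc (λ l _ _ → l ≡ᵇ suc h) toBlockForm
  where
  toBlockForm : ∀ {A} → 𝓑 n A → T (lhs A ≡ᵇ suc h) ⊎ T (iuc A ≡ᵇ h) → BlockForm A
  toBlockForm {A} (bg , sp) t with shape {A} bg
  ... | flat      with s≤s () ← subst (3 ≤_) (sym sp) 3≤n
  ... | blocks bf = bf
  ... | oneRow m  = ⊥-elim (n≮n m (too-wide t))
    where
    h<m : suc h ≤ m
    h<m = subst (λ k → suc h ≤ k ∸ 2) (trans (sym sp) (semiperimeter-row m)) 1+h≤n∸2
    too-wide : T (lhs (row m) ≡ᵇ suc h) ⊎ T (iuc (row m) ≡ᵇ h) → m < m
    too-wide (inj₁ t) = subst (_≤ m) (trans (sym (≡ᵇ⇒≡ _ _ t)) (lhs-row m)) h<m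
    too-wide (inj₂ t) = subst (_≤ m) (trans (sym (≡ᵇ⇒≡ _ _ t)) (iuc-row m)) (<⇒≤ h<m)

1≤lhs : ∀ {A} → IsBargraph A → 1 ≤ lhs A
1≤lhs {A} bg with shape {A} bg
... | flat      = s≤s z≤n
... | oneRow m  = subst (1 ≤_) (sym (lhs-row m)) (s≤s z≤n)
... | blocks bf = subst (1 ≤_) (sym (lhs≡suc-iuc∘φ bf)) (s≤s z≤n)

T-∧≡ᵇ∧≡ᵇ⇔ : ∀ x h u {a b} → T (x ∧ (h ≡ᵇ a) ∧ (u ≡ᵇ b)) ⇔ (T x × h ≡ a × u ≡ b)
T-∧≡ᵇ∧≡ᵇ⇔ x h u {a} {b} = mk⇔
  (λ t → let tx , t′ = Equivalence.to T-∧ t ; th , tu = Equivalence.to T-∧ t′ in tx , ≡ᵇ⇒≡ h a th , ≡ᵇ⇒≡ u b tu)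
  (λ (tx , h≡a , u≡b) → Equivalence.from T-∧ (tx , Equivalence.from T-∧ (≡⇒≡ᵇ h a h≡a , ≡⇒≡ᵇ u b u≡b)))

txyOver1-tx-t⁰ : ∀ a b → txyOver1-tx 0 a b ≡ 0ℤ
txyOver1-tx-t⁰ zero    b = refl
txyOver1-tx-t⁰ (suc a) b = refl

txyOver1-tx-y≢1 : ∀ k a b → (b ≡ᵇ 1) ≡ false → txyOver1-tx k a b ≡ 0ℤ
txyOver1-tx-y≢1 k a b b≢1 rewrite b≢1 | ∧-zeroʳ (not (k ≡ᵇ 0)) | ∧-zeroʳ (k ≡ᵇ a) = refl

txyOver1-tx-diagonal : ∀ m → txyOver1-tx (suc m) (suc m) 1 ≡ ℤ.1ℤ
txyOver1-tx-diagonal zero    = refl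
txyOver1-tx-diagonal (suc m) = txyOver1-tx-diagonal m

≢⇒≡ᵇ≡false : ∀ {m n} → m ≢ n → (m ≡ᵇ n) ≡ false
≢⇒≡ᵇ≡false {m} {n} m≢n with m ≡ᵇ n in eq
... | false = refl
... | true  = ⊥-elim (m≢n (≡ᵇ⇒≡ m n (subst T (sym eq) _)))

txyOver1-tx-offDiagonal : ∀ m a → m ≢ a → txyOver1-tx (suc m) (suc a) 1 ≡ 0ℤ
txyOver1-tx-offDiagonal m a m≢a = cong (λ c → if c ∧ true then ℤ.1ℤ else 0ℤ) (≢⇒≡ᵇ≡false m≢a)

bargraphGF-y¹ : ∀ (st : Path → ℕ) → (∀ m → st (row m) ≡ suc m) → ∀ k a → bargraphGF st k a 1 ≡ txyOver1-tx k a 1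
bargraphGF-y¹ st st-row = coefficient
  where
  isRow : ∀ {n k a A} → 𝓑 n A → T ((st A ≡ᵇ k) ∧ (#H A ≡ᵇ a) ∧ (#U A ≡ᵇ 1)) →
          Σ ℕ λ m → A ≡ row m × suc m ≡ k × suc m ≡ a
  isRow {k = k} {A = A} (bg , _) t with st≡k , #H≡a , #U≡1 ← Equivalence.to (T-∧≡ᵇ∧≡ᵇ⇔ (st A ≡ᵇ k) (#H A) (#U A)) t
                                   with m , refl ← #U≡1⇒row {A} bg #U≡1
    = m , refl , trans (sym (st-row m)) (≡ᵇ⇒≡ _ _ st≡k) , trans (sym (#H-row m)) #H≡a

  coefficient : ∀ k a → bargraphGF st k a 1 ≡ txyOver1-tx k a 1
  coefficient zero a = trans (cong ℤ.+_ (countB-none none)) (sym (txyOver1-tx-t⁰ a 1))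
    where
    none : ∀ A → 𝓑 (a + 1) A → ¬ T ((st A ≡ᵇ 0) ∧ (#H A ≡ᵇ a) ∧ (#U A ≡ᵇ 1))
    none A bA t with _ , _ , () , _ ← isRow {A = A} bA t
  coefficient (suc m) zero = cong ℤ.+_ (countB-none none)
    where
    none : ∀ A → 𝓑 1 A → ¬ T ((st A ≡ᵇ suc m) ∧ (#H A ≡ᵇ 0) ∧ (#U A ≡ᵇ 1))
    none A bA t with _ , _ , _ , () ← isRow {A = A} bA t
  coefficient (suc m) (suc a) with m ≟ a
  ... | yes refl = trans (cong ℤ.+_ (countB-single (row-isBargraph m , sp) row-selected unique)) (sym (txyOver1-tx-diagonal m))
    where
    sp : semiperimeter (row m) ≡ suc m + 1
    sp = trans (semiperimeter-row m) (cong suc (+-comm 1 m))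
    row-selected : T ((st (row m) ≡ᵇ suc m) ∧ (#H (row m) ≡ᵇ suc m) ∧ (#U (row m) ≡ᵇ 1))
    row-selected = Equivalence.from (T-∧≡ᵇ∧≡ᵇ⇔ (st (row m) ≡ᵇ suc m) (#H (row m)) (#U (row m)))
                                    (≡⇒≡ᵇ _ _ (st-row m) , #H-row m , #U-row m)
    unique : ∀ A → 𝓑 (suc m + 1) A → T ((st A ≡ᵇ suc m) ∧ (#H A ≡ᵇ suc m) ∧ (#U A ≡ᵇ 1)) → A ≡ row m
    unique A bA t with j , refl , j+1≡m+1 , _ ← isRow {A = A} bA t = cong row (suc-injective j+1≡m+1)
  ... | no m≢a = trans (cong ℤ.+_ (countB-none none)) (sym (txyOver1-tx-offDiagonal m a m≢a))
    where
    none : ∀ A → 𝓑 (suc a + 1) A → ¬ T ((st A ≡ᵇ suc m) ∧ (#H A ≡ᵇ suc a) ∧ (#U A ≡ᵇ 1))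
    none A bA t with _ , _ , j+1≡m+1 , j+1≡a+1 ← isRow {A = A} bA t = m≢a (suc-injective (trans (sym j+1≡m+1) j+1≡a+1))

K-t⁰ : ∀ a b → K 0 a b ≡ 0ℤ
K-t⁰ a b = cong ℤ.+_ (countB-none none)
  where
  none : ∀ A → 𝓑 (a + b) A → ¬ T ((lhs A ≡ᵇ 0) ∧ (#H A ≡ᵇ a) ∧ (#U A ≡ᵇ b))
  none A (bg , _) t
    with () ← subst (1 ≤_) (≡ᵇ⇒≡ _ _ (proj₁ (Equivalence.to (T-∧≡ᵇ∧≡ᵇ⇔ (lhs A ≡ᵇ 0) (#H A) (#U A)) t)))
                    (1≤lhs {A} bg)

K≡I-y⁰ : ∀ k a → K (suc k) a 0 ≡ I k a 0
K≡I-y⁰ k a = cong ℤ.+_ (countB-cong equivalent)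
  where
  P : ℕ → ℕ → ℕ → Bool
  P l h u = (l ≡ᵇ suc k) ∧ (h ≡ᵇ a) ∧ (u ≡ᵇ 0)
  equivalent : ∀ A → 𝓑 (a + 0) A → T (P (lhs A) (#H A) (#U A)) ⇔ T (P (suc (iuc A)) (#H A) (#U A))
  equivalent A (bg , _) =
    mk⇔ (λ t → subst (λ l → T (P l (#H A) (#U A))) (lhs≡suc-iuc (#U≡0 (lhs A) t)) t)
        (λ t → subst (λ l → T (P l (#H A) (#U A))) (sym (lhs≡suc-iuc (#U≡0 (suc (iuc A)) t))) t)
    where
    #U≡0 : ∀ l → T (P l (#H A) (#U A)) → #U A ≡ 0
    #U≡0 l t = proj₂ (proj₂ (Equivalence.to (T-∧≡ᵇ∧≡ᵇ⇔ (l ≡ᵇ suc k) (#H A) (#U A)) t))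
    lhs≡suc-iuc : #U A ≡ 0 → lhs A ≡ suc (iuc A)
    lhs≡suc-iuc #U≡0 with refl ← #U≡0⇒flat {A} bg #U≡0 = refl

K≡I-y²⁺ : ∀ k a b → K (suc k) a (2 + b) ≡ I k a (2 + b)
K≡I-y²⁺ k a b = cong ℤ.+_ (countB-lhs≡suc-iuc P toBlockForm)
  where
  P : ℕ → ℕ → ℕ → Bool
  P l h u = (l ≡ᵇ suc k) ∧ (h ≡ᵇ a) ∧ (u ≡ᵇ 2 + b)
  toBlockForm : ∀ {A} → 𝓑 (a + (2 + b)) A → T (P (lhs A) (#H A) (#U A)) ⊎ T (P (suc (iuc A)) (#H A) (#U A)) → BlockForm A
  toBlockForm {A} (bg , _) t = bargraph-BlockForm A bg (subst (2 ≤_) (sym (#U≡2+b t)) (s≤s (s≤s z≤n)))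
    where
    #U≡2+b : T (P (lhs A) (#H A) (#U A)) ⊎ T (P (suc (iuc A)) (#H A) (#U A)) → #U A ≡ 2 + b
    #U≡2+b (inj₁ t) = proj₂ (proj₂ (Equivalence.to (T-∧≡ᵇ∧≡ᵇ⇔ (lhs A ≡ᵇ suc k) (#H A) (#U A)) t))
    #U≡2+b (inj₂ t) = proj₂ (proj₂ (Equivalence.to (T-∧≡ᵇ∧≡ᵇ⇔ (iuc A ≡ᵇ k) (#H A) (#U A)) t))

lhs-iuc-generatingFunctions : ∀ k a b → (K −ₛ txyOver1-tx) k a b ≡ (t· (I −ₛ txyOver1-tx)) k a b
lhs-iuc-generatingFunctions zero a b = cong₂ ℤ._-_ (K-t⁰ a b) (txyOver1-tx-t⁰ a b)
lhs-iuc-generatingFunctions (suc k) a zero =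
  cong₂ ℤ._-_ (K≡I-y⁰ k a) (trans (txyOver1-tx-y≢1 (suc k) a 0 refl) (sym (txyOver1-tx-y≢1 k a 0 refl)))
lhs-iuc-generatingFunctions (suc k) a (suc zero) =
  trans (ℤ.i≡j⇒i-j≡0 (bargraphGF-y¹ lhs lhs-row (suc k) a)) (sym (ℤ.i≡j⇒i-j≡0 (bargraphGF-y¹ iuc iuc-row k a)))
lhs-iuc-generatingFunctions (suc k) a (suc (suc b)) =
  cong₂ ℤ._-_ (K≡I-y²⁺ k a b) (trans (txyOver1-tx-y≢1 (suc k) a (2 + b) refl) (sym (txyOver1-tx-y≢1 k a (2 + b) refl)))

mainTheorem16 :
    (Σ (Path → Path) λ φ → Σ (Path → Path) λ ψ →
        (∀ A → IsBargraph A → 2 ≤ #U A → IsBargraph (φ A) × 2 ≤ #U (φ A))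
      × (∀ A → IsBargraph A → 2 ≤ #U A → IsBargraph (ψ A) × 2 ≤ #U (ψ A))
      × (∀ A → IsBargraph A → 2 ≤ #U A → ψ (φ A) ≡ A)
      × (∀ A → IsBargraph A → 2 ≤ #U A → φ (ψ A) ≡ A)
      × (∀ A → IsBargraph A → 2 ≤ #U A →
            (#U (φ A) ≡ #U A) × (#H (φ A) ≡ #H A) × (iuc (φ A) ≡ lhs A ∸ 1)))
    × (∀ n h → 3 ≤ n → 1 ≤ h → h ≤ n ∸ 2 →
         countB n (λ A → lhs A ≡ᵇ h) ≡ countB n (λ A → iuc A ≡ᵇ (h ∸ 1)))
    × (∀ k a b → (K −ₛ txyOver1-tx) k a b ≡ (t· (I −ₛ txyOver1-tx)) k a b)
mainTheorem16 =
  ( φ , ψ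
  , (λ A bg u → rebalancing-domain (φ-rebalancing (bargraph-BlockForm A bg u)) bg)
  , (λ A bg u → rebalancing-domain (ψ-rebalancing (bargraph-BlockForm A bg u)) bg)
  , (λ A bg u → ψ∘φ (bargraph-BlockForm A bg u))
  , (λ A bg u → φ∘ψ (bargraph-BlockForm A bg u))
  , (λ A bg u → let bf = bargraph-BlockForm A bg u ; r = φ-rebalancing bf in
       rebalancing-#U r , rebalancing-#H r , cong (_∸ 1) (sym (lhs≡suc-iuc∘φ bf))))
  , lhs-iuc-equidistributed
  , lhs-iuc-generatingFunctions
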